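{- Let $G$ be a finite Schur group, let $H\le G$, and let $\Gamma=\Gamma(H,G)$ be the transitive permutation group induced by the action of $G$ by right multiplication on the set $\Omega$ of right cosets of $H$ in $G$. Then every fusion of the association scheme $\mathrm{inv}(\Gamma)$ is schurian.
   Context: An association scheme on a finite set $\Omega$ is a partition $\mathcal R$ of $\Omega\times\Omega$ such that the diagonal $1_\Omega$ belongs to $\mathcal R$, the transpose $R^*=\{(\beta,\alpha):(\alpha,\beta)\in R\}$ of each $R\in\mathcal R$ belongs to $\mathcal R$, and the $\mathbb Z$-span of the adjacency matrices of the relations in $\mathcal R$ is closed under matrix multiplication. For a transitive permutation group $\Gamma$ on $\Omega$, $\mathrm{inv}(\Gamma)$ is the association scheme whose relations are the orbits of $\Gamma$ acting coordinatewise on $\Omega\times\Omega$. A scheme is schurian if it equals $\mathrm{inv}(\Delta)$ for some permutation group $\Delta$ on $\Omega$. A fusion of a scheme $(\Omega,\mathcal R)$ is a scheme $(\Omega,\mathcal R')$ each of whose relations is a union of relations of $\mathcal R$. Schur group: for a finite group $G$ with identity $e$, an S-ring over $G$ is a subring $\mathcal A=\mathrm{Span}_{\mathbb Z}\{\underline X:X\in\mathcal S\}$ of $\mathbb ZG$ for a partition $\mathcal S$ of $G$ with $\{e\}\in\mathcal S$ and $X^{ -1}\in\mathcal S$ for $X\in\mathcal S$ ($\underline X$ the sum of the elements of $X$); it is schurian if $\mathcal S$ is the set of orbits of $\Gamma_e$ for some $\Gamma\le\mathrm{Sym}(G)$ containing the right multiplications; $G$ is a Schur group if all S-rings over $G$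 are schurian. -}

module Defs where

open import Level using (0ℓ)
open import Data.Nat using (ℕ; zero; suc)
open import Data.Fin using (Fin; zero; suc; _≟_)
open import Data.Fin.Permutation using (Permutation′; _⟨$⟩ʳ_; id; flip; _∘ₚ_; _≈_)
open import Data.Integer using (ℤ; 0ℤ; 1ℤ; _+_; _*_)
open import Data.Product using (Σ; ∃; ∃-syntax; _×_; _,_)
open import Data.Bool using (if_then_else_)
open import Relation.Nullary.Decidable using (⌊_⌋)
open import Relation.Binary.PropositionalEquality using (_≡_)
open import Function.Bundles using (_⇔_)

sumFin : (n : ℕ) → (Fin n → ℤ) → ℤ
sumFin zero    f = 0ℤ
sumFin (suc n) f = f zero + sumFin n (λ i → f (suc i))

ind : ∀ {r} → Fin r → Fin r → ℤ
ind a b = if ⌊ a ≟ b ⌋ then 1ℤ else 0ℤ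

Surjective : ∀ {A : Set} {r} → (A → Fin r) → Set
Surjective {A} {r} f = (i : Fin r) → ∃[ a ] f a ≡ i

-- Finite groups, with carrier Fin n (any finite group is isomorphic to one)

record FinGroup (n : ℕ) : Set where
  infixl 7 _∙_
  field
    _∙_      : Fin n → Fin n → Fin n
    e        : Fin n
    _⁻¹      : Fin n → Fin n
    assoc    : ∀ x y z → (x ∙ y) ∙ z ≡ x ∙ (y ∙ z)
    identityˡ : ∀ x → e ∙ x ≡ x
    identityʳ : ∀ x → x ∙ e ≡ x
    inverseˡ : ∀ x → (x ⁻¹) ∙ x ≡ e
    inverseʳ : ∀ x → x ∙ (x ⁻¹) ≡ e

record IsSubgroup {n} (G : FinGroup n) (H : Fin n → Set) : Set where
  open FinGroup G
  field
    has-e   : H e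
    ∙-closed : ∀ {x y} → H x → H y → H (x ∙ y)
    ⁻¹-closed : ∀ {x} → H x → H (x ⁻¹)

record IsPermGroup {m} (Δ : Permutation′ m → Set) : Set where
  field
    respects : ∀ {σ τ} → σ ≈ τ → Δ σ → Δ τ
    has-id  : Δ id
    ∘-closed : ∀ {σ τ} → Δ σ → Δ τ → Δ (σ ∘ₚ τ)
    inv-closed : ∀ {σ} → Δ σ → Δ (flip σ)

-- Δ-orbits on Ω × Ω (coordinatewise action): the relations of inv(Δ)
SameOrbit₂ : ∀ {m} → (Permutation′ m → Set) → Fin m → Fin m → Fin m → Fin m → Set
SameOrbit₂ {m} Δ α β α′ β′ = Σ (Permutation′ m) λ σ → (Δ σ × (σ ⟨$⟩ʳ α ≡ α′) × (σ ⟨$⟩ʳ β ≡ β′))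

-- Association schemes on Ω = Fin m.
-- A partition R of Ω × Ω into r classes is given by a surjective
-- colouring c : Ω → Ω → Fin r (class i is the relation {(α,β) | c α β ≡ i}).

adj : ∀ {m r} → (Fin m → Fin m → Fin r) → Fin r → Fin m → Fin m → ℤ
adj c i α β = ind (c α β) i

record IsScheme (m r : ℕ) (c : Fin m → Fin m → Fin r) : Set where
  field
    surj     : ∀ i → ∃[ α ] ∃[ β ] c α β ≡ i
    diagonal : ∃[ d ] (∀ α β → (c α β ≡ d) ⇔ (α ≡ β))
    transpose : ∀ i → ∃[ j ] (∀ α β → (c α β ≡ i) ⇔ (c β α ≡ j))
    -- the ℤ-span of the adjacency matrices is closed under multiplication
    -- (it suffices: A_i A_j lies in the ℤ-span, for all i j)
    closed : ∀ i j → Σ (Fin r → ℤ) λ a → (∀ α β →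
               sumFin m (λ γ → adj c i α γ * adj c j γ β)
                 ≡ sumFin r (λ k → a k * adj c k α β))

IsInvOf : ∀ {m r} → (Fin m → Fin m → Fin r) → (Permutation′ m → Set) → Set
IsInvOf {m} c Δ = ∀ α β α′ β′ → (c α β ≡ c α′ β′) ⇔ SameOrbit₂ Δ α β α′ β′

IsSchurianScheme : ∀ {m r} → (Fin m → Fin m → Fin r) → Set₁
IsSchurianScheme {m} c = Σ (Permutation′ m → Set) (λ Δ → IsPermGroup Δ × IsInvOf c Δ)

IsFusionOfInv : ∀ {m r} → (Permutation′ m → Set) → (Fin m → Fin m → Fin r) → Set
IsFusionOfInv {m} {r} Γ c =
  IsScheme m r c × (∀ α β α′ β′ → SameOrbit₂ Γ α β α′ β′ → c α β ≡ c α′ β′)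

-- S-rings over a finite group G (carrier Fin n).
-- The partition S of G into r classes is a surjective colouring s : G → Fin r.

module _ {n : ℕ} (G : FinGroup n) where
  open FinGroup G

  record IsSRing (r : ℕ) (s : Fin n → Fin r) : Set where
    field
      surj    : Surjective s
      unit    : ∀ x → (s x ≡ s e) ⇔ (x ≡ e)
      inverse : ∀ i → ∃[ j ] (∀ x → (s x ≡ i) ⇔ (s (x ⁻¹) ≡ j))
      -- the ℤ-span of the X̲ is closed under multiplication:
      -- coefficient of g in X̲_i X̲_j is #{x | x ∈ X_i, x⁻¹g ∈ X_j}
      closed  : ∀ i j → Σ (Fin r → ℤ) λ a → (∀ g →
                  sumFin n (λ x → ind (s x) i * ind (s ((x ⁻¹) ∙ g)) j)
                    ≡ sumFin r (λ k → a k * ind (s g) k))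

  RightMult : Fin n → Permutation′ n → Set
  RightMult g σ = ∀ x → σ ⟨$⟩ʳ x ≡ x ∙ g

  IsSchurianSRing : ∀ {r} → (Fin n → Fin r) → Set₁
  IsSchurianSRing s =
    Σ (Permutation′ n → Set) (λ Γ → IsPermGroup Γ
           × (∀ g σ → RightMult g σ → Γ σ)
           × (∀ x y → (s x ≡ s y) ⇔ (Σ (Permutation′ n) (λ σ → Γ σ × (σ ⟨$⟩ʳ e ≡ e) × (σ ⟨$⟩ʳ x ≡ y)))))

  IsSchurGroup : Set₁
  IsSchurGroup = ∀ r (s : Fin n → Fin r) → IsSRing r s → IsSchurianSRing s

  -- Right cosets of H: Ω = Fin m together with a surjection π : G → Ω
  -- whose fibres are exactly the right cosets Hx (Hx = Hy ⇔ x y⁻¹ ∈ H).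
  IsRightCosetSpace : (H : Fin n → Set) (m : ℕ) → (Fin n → Fin m) → Set
  IsRightCosetSpace H m π =
    Surjective π × (∀ x y → (π x ≡ π y) ⇔ H (x ∙ (y ⁻¹)))

  -- Γ(H,G): the permutations of Ω induced by right multiplication,
  -- Hx ↦ Hxg, for g ∈ G.
  InducedGroup : ∀ {m} → (Fin n → Fin m) → Permutation′ m → Set
  InducedGroup π σ = ∃[ g ] (∀ x → σ ⟨$⟩ʳ π x ≡ π (x ∙ g))

-- Let c be a fusion of inv(Γ(H,G)) on the coset space Ω = H\G.  Since c
-- is invariant under right multiplication, c(Hx, Hy) depends only on
-- z = yx⁻¹, through col z = c(H, Hz).  Lift c to G: give e its own colour
-- and z ≠ e the colour col z.  The resulting partition u of G is an S-ring
-- partition (its structure counts are |H| times the intersection numbers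
-- of c, up to correction terms living on {e}), so, G being a Schur group,
-- its classes are the orbits of the stabiliser of e in a group Γ′ ≥ G_right.
-- Every τ ∈ Γ′ preserves the u-class, hence the col-class, of yx⁻¹; so τ
-- maps cosets to cosets and induces a permutation of Ω.  The induced group
-- Δ preserves c, and conversely every two pairs of the same colour are
-- related by Δ: c = inv(Δ).
module Submission where

open import Defs
open import Level using (0ℓ)
open import Data.Nat using (ℕ; zero; suc)
open import Data.Fin using (Fin; zero; suc; _≟_; punchIn; punchOut)
import Data.Fin.Properties as FinP
open import Data.Fin.Permutation as Perm
  using (Permutation′; _⟨$⟩ʳ_; _⟨$⟩ˡ_; permutation; id; flip; _∘ₚ_)
open import Data.Integer using (ℤ; 0ℤ; 1ℤ; _+_; _*_)
import Data.Integer.Properties as ℤP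
open import Data.Integer.Tactic.RingSolver using (solve-∀)
open import Algebra.Bundles using (Group)
open import Algebra.Properties.AbelianGroup ℤP.+-0-abelianGroup using () renaming (∙-cancelʳ to +-cancelʳ)
open import Algebra.Properties.Semiring.Sum ℤP.+-*-semiring
  using (sum; ∑-distrib-+; ∑-comm; *-distribˡ-sum; sum-permute)
open import Data.Product using (Σ; ∃-syntax; _×_; _,_; proj₁; proj₂)
open import Data.Empty using (⊥-elim)
open import Relation.Nullary using (¬?; yes; no; Dec)
open import Relation.Nullary.Decidable using (_×-dec_)
open import Relation.Binary.PropositionalEquality
open import Function.Bundles using (_⇔_; mk⇔; Equivalence)
open import Function.Construct.Symmetry using (⇔-sym)
open import Function.Construct.Composition using (_⇔-∘_)

sumFin≡sum : ∀ n f → sumFin n f ≡ sum f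
sumFin≡sum zero    f = refl
sumFin≡sum (suc n) f = cong (f zero +_) (sumFin≡sum n (λ i → f (suc i)))

sumFin-cong : ∀ n {f g : Fin n → ℤ} → (∀ i → f i ≡ g i) → sumFin n f ≡ sumFin n g
sumFin-cong zero    eq = refl
sumFin-cong (suc n) eq = cong₂ _+_ (eq zero) (sumFin-cong n (λ i → eq (suc i)))

sumFin-+ : ∀ n (f g : Fin n → ℤ) → sumFin n (λ i → f i + g i) ≡ sumFin n f + sumFin n g
sumFin-+ n f g
  rewrite sumFin≡sum n (λ i → f i + g i) | sumFin≡sum n f | sumFin≡sum n g = ∑-distrib-+ f g

sumFin-*ˡ : ∀ n k (f : Fin n → ℤ) → sumFin n (λ i → k * f i) ≡ k * sumFin n f
sumFin-*ˡ n k f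
  rewrite sumFin≡sum n (λ i → k * f i) | sumFin≡sum n f = sym (*-distribˡ-sum k f)

sumFin-swap : ∀ n m (f : Fin n → Fin m → ℤ) →
  sumFin n (λ i → sumFin m (λ j → f i j)) ≡ sumFin m (λ j → sumFin n (λ i → f i j))
sumFin-swap n m f = begin
  sumFin n (λ i → sumFin m (f i))  ≡⟨ sumFin-cong n (λ i → sumFin≡sum m (f i)) ⟩
  sumFin n (λ i → sum (f i))       ≡⟨ sumFin≡sum n _ ⟩
  sum (λ i → sum (f i))            ≡⟨ ∑-comm f ⟩
  sum (λ j → sum (λ i → f i j))    ≡˘⟨ sumFin≡sum m _ ⟩
  sumFin m (λ j → sum (λ i → f i j))  ≡˘⟨ sumFin-cong m (λ j → sumFin≡sum n (λ i → f i j)) ⟩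
  sumFin m (λ j → sumFin n (λ i → f i j)) ∎
  where open ≡-Reasoning

sumFin-reindex : ∀ n (φ ψ : Fin n → Fin n) → (∀ x → φ (ψ x) ≡ x) → (∀ x → ψ (φ x) ≡ x) →
  (f : Fin n → ℤ) → sumFin n f ≡ sumFin n (λ x → f (φ x))
sumFin-reindex n φ ψ φψ ψφ f
  rewrite sumFin≡sum n f | sumFin≡sum n (λ x → f (φ x)) = sum-permute f (permutation φ ψ φψ ψφ)

ind-yes : ∀ {r} {a b : Fin r} → a ≡ b → ind a b ≡ 1ℤ
ind-yes {a = a} {b} p with a ≟ b
... | yes _ = refl
... | no q  = ⊥-elim (q p)

ind-no : ∀ {r} {a b : Fin r} → a ≢ b → ind a b ≡ 0ℤ
ind-no {a = a} {b} p with a ≟ b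
... | yes q = ⊥-elim (p q)
... | no _  = refl

ind-iff : ∀ {k k′} {a b : Fin k} {a′ b′ : Fin k′} → (a ≡ b ⇔ a′ ≡ b′) → ind a b ≡ ind a′ b′
ind-iff {a = a} {b} eqv with a ≟ b
... | yes q = sym (ind-yes (Equivalence.to eqv q))
... | no q  = sym (ind-no (λ t → q (Equivalence.from eqv t)))

ind-sym : ∀ {r} (a b : Fin r) → ind a b ≡ ind b a
ind-sym a b = ind-iff (mk⇔ sym sym)

ind-suc : ∀ {r} (a b : Fin r) → ind (suc a) (suc b) ≡ ind a b
ind-suc a b = ind-iff (mk⇔ FinP.suc-injective (cong suc))

sumFin-delta : ∀ n (t : Fin n) (f : Fin n → ℤ) → sumFin n (λ i → ind i t * f i) ≡ f t
sumFin-delta (suc n) zero f = begin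
  1ℤ * f zero + sumFin n (λ i → ind (suc i) zero * f (suc i))
    ≡⟨ cong₂ _+_ (ℤP.*-identityˡ (f zero))
                 (sumFin-cong n (λ i → cong (_* f (suc i)) (ind-no {a = suc i} {b = zero} λ ()))) ⟩
  f zero + sumFin n (λ i → 0ℤ * f (suc i))
    ≡⟨ cong (f zero +_) (sumFin-*ˡ n 0ℤ (λ i → f (suc i))) ⟩
  f zero + 0ℤ * sumFin n (λ i → f (suc i))
    ≡⟨ ℤP.+-identityʳ (f zero) ⟩
  f zero ∎
  where open ≡-Reasoning
sumFin-delta (suc n) (suc t) f = begin
  0ℤ * f zero + sumFin n (λ i → ind (suc i) (suc t) * f (suc i))
    ≡⟨ cong (0ℤ +_) (sumFin-cong n (λ i → cong (_* f (suc i)) (ind-suc i t))) ⟩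
  0ℤ + sumFin n (λ i → ind i t * f (suc i))
    ≡⟨ ℤP.+-identityˡ _ ⟩
  sumFin n (λ i → ind i t * f (suc i))
    ≡⟨ sumFin-delta n t (λ i → f (suc i)) ⟩
  f (suc t) ∎
  where open ≡-Reasoning

sumFin-delta′ : ∀ n (t : Fin n) (f : Fin n → ℤ) → sumFin n (λ i → f i * ind t i) ≡ f t
sumFin-delta′ n t f =
  trans (sumFin-cong n (λ i → trans (ℤP.*-comm (f i) (ind t i)) (cong (_* f i) (ind-sym t i))))
        (sumFin-delta n t f)

module GroupLaws {n : ℕ} (G : FinGroup n) where
  open FinGroup G

  group : Group 0ℓ 0ℓ
  group = record
    { Carrier = Fin n ; _≈_ = _≡_ ; _∙_ = _∙_ ; ε = e ; _⁻¹ = _⁻¹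
    ; isGroup = record
      { isMonoid = record
        { isSemigroup = record
          { isMagma = record { isEquivalence = isEquivalence ; ∙-cong = cong₂ _∙_ }
          ; assoc = assoc }
        ; identity = identityˡ , identityʳ }
      ; inverse = inverseˡ , inverseʳ
      ; ⁻¹-cong = cong _⁻¹ } }

  open import Algebra.Properties.Group group public

-- IsSRing
-- of Defs asks for a surjective colouring; the partition we build does not
-- always use all its colours, so we first state the S-ring axioms for the
-- partition itself, then relabel the classes without gaps.
module SRingPartitions {n : ℕ} (G : FinGroup n) where
  open FinGroup G
  open GroupLaws G

  -- the coefficient of g in the product X̲_i X̲_j of two colour classes
  structureCount : ∀ {k} → (Fin n → Fin k) → Fin k → Fin k → Fin n → ℤ
  structureCount u i j g = sumFin n (λ x → ind (u x) i * ind (u (x ⁻¹ ∙ g)) j)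

  record IsSRingPartition {k} (u : Fin n → Fin k) : Set where
    field
      unit    : ∀ x → u x ≡ u e → x ≡ e
      inverse : ∀ x y → u x ≡ u y → u (x ⁻¹) ≡ u (y ⁻¹)
      closed  : ∀ i j g g′ → u g ≡ u g′ → structureCount u i j g ≡ structureCount u i j g′

  record Compression {k} (u : Fin n → Fin k) : Set where
    field
      size    : ℕ
      s       : Fin n → Fin size
      s-surj  : Surjective s
      f       : Fin size → Fin k
      f-inj   : ∀ a b → f a ≡ f b → a ≡ b
      factors : ∀ x → u x ≡ f (s x)

  identityCompression : ∀ {k} {u : Fin n → Fin k} → Surjective u → Compression u
  identityCompression {k} {u} surj =
    record { size = k ; s = u ; s-surj = surj ; f = λ a → a ; f-inj = λ _ _ q → q ; factors = λ _ → refl }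

  punchOutCompression : ∀ {k} {u : Fin n → Fin (suc k)} (i : Fin (suc k)) (miss : ∀ x → u x ≢ i) →
    (∀ j → j ≢ i → ∃[ x ] u x ≡ j) → Compression u
  punchOutCompression {k} {u} i miss hits = record
    { size = k ; s = s ; s-surj = s-surj ; f = punchIn i
    ; f-inj = FinP.punchIn-injective i
    ; factors = λ x → sym (FinP.punchIn-punchOut (λ q → miss x (sym q))) }
    where
    s : Fin n → Fin k
    s x = punchOut (λ q → miss x (sym q))
    s-surj : Surjective s
    s-surj a with hits (punchIn i a) (FinP.punchInᵢ≢i i a)
    ... | x , ux = x , trans (FinP.punchOut-cong′ i ux) (FinP.punchOut-punchIn i)

  StabiliserOrbit : (Permutation′ n → Set) → Fin n → Fin n → Set
  StabiliserOrbit Γ′ x y = Σ (Permutation′ n) λ σ → Γ′ σ × (σ ⟨$⟩ʳ e ≡ e) × (σ ⟨$⟩ʳ x ≡ y)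

  record SchurianPartition {k} (u : Fin n → Fin k) : Set₁ where
    field
      Γ′            : Permutation′ n → Set
      isPermGroup   : IsPermGroup Γ′
      has-rightMult : ∀ g σ → RightMult G g σ → Γ′ σ
      orbits        : ∀ x y → (u x ≡ u y) ⇔ StabiliserOrbit Γ′ x y

  module _ {k} {u : Fin n → Fin k} (part : IsSRingPartition u) (comp : Compression u) where
    open IsSRingPartition part
    open Compression comp

    private
      rep : Fin size → Fin n
      rep a = proj₁ (s-surj a)

      rep-spec : ∀ a → s (rep a) ≡ a
      rep-spec a = proj₂ (s-surj a)

    same-class : ∀ x y → (s x ≡ s y) ⇔ (u x ≡ u y)
    same-class x y = mk⇔ (λ q → trans (factors x) (trans (cong f q) (sym (factors y))))
                         (λ q → f-inj _ _ (trans (sym (factors x)) (trans q (factors y))))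

    structureCount-f : ∀ a b g → structureCount s a b g ≡ structureCount u (f a) (f b) g
    structureCount-f a b g = sumFin-cong n λ x → cong₂ _*_ (ind-iff (colour x a)) (ind-iff (colour (x ⁻¹ ∙ g) b))
      where
      colour : ∀ x a → (s x ≡ a) ⇔ (u x ≡ f a)
      colour x a = mk⇔ (λ q → trans (factors x) (cong f q)) (λ q → f-inj _ _ (trans (sym (factors x)) q))

    compressed-isSRing : IsSRing G size s
    compressed-isSRing = record
      { surj    = s-surj
      ; unit    = λ x → mk⇔ (λ q → unit x (Equivalence.to (same-class x e) q)) (cong s)
      ; inverse = λ a → s (rep a ⁻¹) , λ x → mk⇔ (inverse-to a x) (inverse-from a x)
      ; closed  = λ a b → (λ c → structureCount s a b (rep c)) , λ g → sym (closed-at a b g)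
      }
      where
      inverse-to : ∀ a x → s x ≡ a → s (x ⁻¹) ≡ s (rep a ⁻¹)
      inverse-to a x q = Equivalence.from (same-class _ _)
        (inverse x (rep a) (Equivalence.to (same-class _ _) (trans q (sym (rep-spec a)))))
      inverse-from : ∀ a x → s (x ⁻¹) ≡ s (rep a ⁻¹) → s x ≡ a
      inverse-from a x q = trans (Equivalence.from (same-class _ _)
        (subst₂ (λ y z → u y ≡ u z) (⁻¹-involutive x) (⁻¹-involutive (rep a))
          (inverse _ _ (Equivalence.to (same-class _ _) q)))) (rep-spec a)
      closed-at : ∀ a b g →
        sumFin size (λ c → structureCount s a b (rep c) * ind (s g) c) ≡ structureCount s a b g
      closed-at a b g = begin
        sumFin size (λ c → structureCount s a b (rep c) * ind (s g) c)
          ≡⟨ sumFin-delta′ size (s g) (λ c → structureCount s a b (rep c)) ⟩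
        structureCount s a b (rep (s g))
          ≡⟨ structureCount-f a b _ ⟩
        structureCount u (f a) (f b) (rep (s g))
          ≡⟨ closed (f a) (f b) _ _ (Equivalence.to (same-class _ _) (rep-spec (s g))) ⟩
        structureCount u (f a) (f b) g
          ≡˘⟨ structureCount-f a b g ⟩
        structureCount s a b g ∎
        where open ≡-Reasoning

    schurian-partition : IsSchurGroup G → SchurianPartition u
    schurian-partition schur with schur size s compressed-isSRing
    ... | Γ′ , isPermGroup , rightMult , orbits = record
      { Γ′ = Γ′ ; isPermGroup = isPermGroup ; has-rightMult = rightMult
      ; orbits = λ x y → orbits x y ⇔-∘ ⇔-sym (same-class x y) }

module CosetSpace {n : ℕ} (G : FinGroup n) (H : Fin n → Set)
  (m : ℕ) (π : Fin n → Fin m) (coset-space : IsRightCosetSpace G H m π) where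
  open FinGroup G
  open GroupLaws G

  rep : Fin m → Fin n
  rep γ = proj₁ (proj₁ coset-space γ)

  rep-spec : ∀ γ → π (rep γ) ≡ γ
  rep-spec γ = proj₂ (proj₁ coset-space γ)

  Compatible : (Fin n → Fin n) → Set
  Compatible φ = ∀ x y → π x ≡ π y → π (φ x) ≡ π (φ y)

  Induces : Permutation′ n → Permutation′ m → Set
  Induces τ σ = ∀ x → σ ⟨$⟩ʳ π x ≡ π (τ ⟨$⟩ʳ x)

  induce : (τ : Permutation′ n) → Compatible (τ ⟨$⟩ʳ_) → Compatible (τ ⟨$⟩ˡ_) →
    Σ (Permutation′ m) (Induces τ)
  induce τ compat compat⁻¹ = permutation to from to-from from-to , to-π
    where
    to from : Fin m → Fin m
    to γ = π (τ ⟨$⟩ʳ rep γ)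
    from γ = π (τ ⟨$⟩ˡ rep γ)
    to-π : ∀ x → to (π x) ≡ π (τ ⟨$⟩ʳ x)
    to-π x = compat _ _ (rep-spec (π x))
    from-π : ∀ x → from (π x) ≡ π (τ ⟨$⟩ˡ x)
    from-π x = compat⁻¹ _ _ (rep-spec (π x))
    to-from : ∀ γ → to (from γ) ≡ γ
    to-from γ = trans (to-π _) (trans (cong π (Perm.inverseʳ τ)) (rep-spec γ))
    from-to : ∀ γ → from (to γ) ≡ γ
    from-to γ = trans (from-π _) (trans (cong π (Perm.inverseˡ τ)) (rep-spec γ))

  rightMult : Fin n → Permutation′ n
  rightMult g = permutation (_∙ g) (_∙ g ⁻¹) (λ x → //-rightDividesˡ g x) (λ x → //-rightDividesʳ g x)

  -- (xg)(yg)⁻¹ = xy⁻¹, so right multiplication preserves right cosets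
  rightMult-compatible : ∀ g → Compatible (_∙ g)
  rightMult-compatible g x y p = Equivalence.from (proj₂ coset-space (x ∙ g) (y ∙ g))
    (subst H (sym quotient) (Equivalence.to (proj₂ coset-space x y) p))
    where
    open ≡-Reasoning
    quotient : x ∙ g ∙ (y ∙ g) ⁻¹ ≡ x ∙ y ⁻¹
    quotient = begin
      x ∙ g ∙ (y ∙ g) ⁻¹       ≡⟨ cong (x ∙ g ∙_) (⁻¹-anti-homo-∙ y g) ⟩
      x ∙ g ∙ (g ⁻¹ ∙ y ⁻¹)   ≡˘⟨ assoc _ _ _ ⟩
      x ∙ g ∙ g ⁻¹ ∙ y ⁻¹     ≡⟨ cong (_∙ y ⁻¹) (//-rightDividesʳ g x) ⟩
      x ∙ y ⁻¹ ∎

  rightMultΩ : ∀ g → Σ (Permutation′ m) (Induces (rightMult g))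
  rightMultΩ g = induce (rightMult g) (rightMult-compatible g) (rightMult-compatible (g ⁻¹))

  rightMultΩ-induced : ∀ g → InducedGroup G π (proj₁ (rightMultΩ g))
  rightMultΩ-induced g = g , proj₂ (rightMultΩ g)

  fibreSize : Fin m → ℤ
  fibreSize γ = sumFin n (λ x → ind γ (π x))

  fibreSize-constant : ∀ γ → fibreSize γ ≡ fibreSize (π e)
  fibreSize-constant γ = begin
    fibreSize γ                               ≡˘⟨ cong fibreSize (rep-spec γ) ⟩
    sumFin n (λ x → ind (π y) (π x))          ≡⟨ sumFin-reindex n (_∙ y) (_∙ y ⁻¹) (//-rightDividesˡ y) (//-rightDividesʳ y) _ ⟩
    sumFin n (λ x → ind (π y) (π (x ∙ y)))    ≡⟨ sumFin-cong n (λ x → ind-iff (mk⇔ (to x) (from x))) ⟩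
    sumFin n (λ x → ind (π e) (π x))          ∎
    where
    open ≡-Reasoning
    y : Fin n
    y = rep γ
    to : ∀ x → π y ≡ π (x ∙ y) → π e ≡ π x
    to x p = subst₂ (λ s t → π s ≡ π t) (inverseʳ y) (//-rightDividesʳ y x) (rightMult-compatible (y ⁻¹) _ _ p)
    from : ∀ x → π e ≡ π x → π y ≡ π (x ∙ y)
    from x p = subst (λ s → π s ≡ π (x ∙ y)) (identityˡ y) (rightMult-compatible y _ _ p)

  sum-over-cosets : ∀ (F : Fin m → ℤ) → sumFin n (λ x → F (π x)) ≡ fibreSize (π e) * sumFin m F
  sum-over-cosets F = begin
    sumFin n (λ x → F (π x))
      ≡˘⟨ sumFin-cong n (λ x → sumFin-delta m (π x) F) ⟩
    sumFin n (λ x → sumFin m (λ γ → ind γ (π x) * F γ))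
      ≡⟨ sumFin-swap n m _ ⟩
    sumFin m (λ γ → sumFin n (λ x → ind γ (π x) * F γ))
      ≡⟨ sumFin-cong m (λ γ → trans (sumFin-cong n (λ x → ℤP.*-comm (ind γ (π x)) (F γ))) (sumFin-*ˡ n (F γ) _)) ⟩
    sumFin m (λ γ → F γ * fibreSize γ)
      ≡⟨ sumFin-cong m (λ γ → trans (cong (F γ *_) (fibreSize-constant γ)) (ℤP.*-comm (F γ) (fibreSize (π e)))) ⟩
    sumFin m (λ γ → fibreSize (π e) * F γ)
      ≡⟨ sumFin-*ˡ m (fibreSize (π e)) F ⟩
    fibreSize (π e) * sumFin m F ∎
    where open ≡-Reasoning

  Induced : (Permutation′ n → Set) → Permutation′ m → Set
  Induced Γ′ σ = Σ (Permutation′ n) λ τ → Γ′ τ × Induces τ σ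

  induced-isPermGroup : ∀ {Γ′} → IsPermGroup Γ′ → IsPermGroup (Induced Γ′)
  induced-isPermGroup {Γ′} Γ′-group = record
    { respects   = λ { σ≈σ′ (τ , τ∈Γ′ , ind) → τ , τ∈Γ′ , λ x → trans (sym (σ≈σ′ (π x))) (ind x) }
    ; has-id     = id , has-id , λ _ → refl
    ; ∘-closed   = λ { {σ₁} {σ₂} (τ₁ , τ₁∈Γ′ , ind₁) (τ₂ , τ₂∈Γ′ , ind₂) →
                        τ₁ ∘ₚ τ₂ , ∘-closed τ₁∈Γ′ τ₂∈Γ′ , λ x → trans (cong (σ₂ ⟨$⟩ʳ_) (ind₁ x)) (ind₂ _) }
    ; inv-closed = λ { {σ} (τ , τ∈Γ′ , ind) → flip τ , inv-closed τ∈Γ′ , λ x → begin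
        flip σ ⟨$⟩ʳ π x                         ≡˘⟨ cong (λ y → flip σ ⟨$⟩ʳ π y) (Perm.inverseʳ τ) ⟩
        flip σ ⟨$⟩ʳ π (τ ⟨$⟩ʳ (τ ⟨$⟩ˡ x))      ≡˘⟨ cong (flip σ ⟨$⟩ʳ_) (ind _) ⟩
        flip σ ⟨$⟩ʳ (σ ⟨$⟩ʳ π (τ ⟨$⟩ˡ x))      ≡⟨ Perm.inverseˡ σ ⟩
        π (τ ⟨$⟩ˡ x) ∎ }
    }
    where
    open IsPermGroup Γ′-group
    open ≡-Reasoning

module Fusion {n : ℕ} (G : FinGroup n) (H : Fin n → Set)
  (m : ℕ) (π : Fin n → Fin m) (coset-space : IsRightCosetSpace G H m π)
  (r : ℕ) (c : Fin m → Fin m → Fin r) (fusion : IsFusionOfInv (InducedGroup G π) c) where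
  open FinGroup G
  open GroupLaws G
  open CosetSpace G H m π coset-space
  open SRingPartitions G
  open IsScheme (proj₁ fusion)

  c-invariant : ∀ x y g → c (π x) (π y) ≡ c (π (x ∙ g)) (π (y ∙ g))
  c-invariant x y g = proj₂ fusion _ _ _ _
    (proj₁ (rightMultΩ g) , rightMultΩ-induced g , proj₂ (rightMultΩ g) x , proj₂ (rightMultΩ g) y)

  col : Fin n → Fin r
  col z = c (π e) (π z)

  c-col : ∀ x y → c (π x) (π y) ≡ col (y ∙ x ⁻¹)
  c-col x y = trans (c-invariant x y (x ⁻¹)) (cong (λ t → c (π t) (π (y ∙ x ⁻¹))) (inverseʳ x))

  col-inverse : ∀ x → col (x ⁻¹) ≡ c (π x) (π e)
  col-inverse x = sym (trans (c-col x e) (cong col (identityˡ _)))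

  d : Fin r
  d = proj₁ diagonal

  col-d : ∀ z → (col z ≡ d) ⇔ (π e ≡ π z)
  col-d z = proj₂ diagonal (π e) (π z)

  col-e : col e ≡ d
  col-e = Equivalence.from (col-d e) refl

  same-coset : ∀ x y → (π x ≡ π y) ⇔ (col (y ∙ x ⁻¹) ≡ d)
  same-coset x y = mk⇔ (λ p → trans (sym (c-col x y)) (Equivalence.from (proj₂ diagonal _ _) p))
                       (λ q → Equivalence.to (proj₂ diagonal _ _) (trans (c-col x y) q))

  col-inverse-determined : ∀ x y → col x ≡ col y → col (x ⁻¹) ≡ col (y ⁻¹)
  col-inverse-determined x y p = begin
    col (x ⁻¹)                 ≡⟨ col-inverse x ⟩
    c (π x) (π e)              ≡⟨ Equivalence.to (transposed (π e) (π x)) refl ⟩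
    proj₁ (transpose (col x))  ≡˘⟨ Equivalence.to (transposed (π e) (π y)) (sym p) ⟩
    c (π y) (π e)              ≡˘⟨ col-inverse y ⟩
    col (y ⁻¹)                 ∎
    where
    open ≡-Reasoning
    transposed : ∀ α β → (c α β ≡ col x) ⇔ (c β α ≡ proj₁ (transpose (col x)))
    transposed = proj₂ (transpose (col x))

  u : Fin n → Fin (suc r)
  u x with x ≟ e
  ... | yes _ = zero
  ... | no _  = suc (col x)

  u-e : ∀ {x} → x ≡ e → u x ≡ zero
  u-e {x} p with x ≟ e
  ... | yes _ = refl
  ... | no q  = ⊥-elim (q p)

  u-ne : ∀ {x} → x ≢ e → u x ≡ suc (col x)
  u-ne {x} p with x ≟ e
  ... | yes q = ⊥-elim (p q)
  ... | no _  = refl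

  u-zero : ∀ x → u x ≡ zero → x ≡ e
  u-zero x p with x ≟ e
  ... | yes q = q
  ... | no _  with p
  ...   | ()

  forget : Fin (suc r) → Fin r
  forget zero    = d
  forget (suc a) = a

  forget-u : ∀ x → forget (u x) ≡ col x
  forget-u x with x ≟ e
  ... | yes q = trans (sym col-e) (cong col (sym q))
  ... | no _  = refl

  u-determines-col : ∀ x y → u x ≡ u y → col x ≡ col y
  u-determines-col x y p = trans (sym (forget-u x)) (trans (cong forget p) (forget-u y))

  ind-u-zero : ∀ x → ind (u x) zero ≡ ind x e
  ind-u-zero x = ind-iff (mk⇔ (u-zero x) u-e)

  ind-u-suc : ∀ x a → ind (u x) (suc a) + ind x e * ind d a ≡ ind (col x) a
  ind-u-suc x a with x ≟ e
  ... | yes refl = trans (ℤP.+-identityˡ _) (trans (ℤP.*-identityˡ _) (cong (λ t → ind t a) (sym col-e)))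
  ... | no _     = trans (cong (_+ 0ℤ * ind d a) (ind-suc (col x) a))
                         (trans (cong (ind (col x) a +_) (ℤP.*-zeroˡ (ind d a))) (ℤP.+-identityʳ _))

  -- the structure counts of the colouring col depend only on col g: up to
  -- the factor |H| they are the intersection numbers of the scheme c
  col-count : ∀ a b g → structureCount col a b g
    ≡ fibreSize (π e) * sumFin r (λ k → proj₁ (closed b a) k * ind (col g) k)
  col-count a b g = begin
    sumFin n (λ x → ind (col x) a * ind (col (x ⁻¹ ∙ g)) b)
      ≡⟨ sumFin-reindex n _⁻¹ _⁻¹ ⁻¹-involutive ⁻¹-involutive _ ⟩
    sumFin n (λ x → ind (col (x ⁻¹)) a * ind (col (x ⁻¹ ⁻¹ ∙ g)) b)
      ≡⟨ sumFin-cong n (λ x → trans (cong₂ (λ s t → ind s a * ind t b) (col-inverse x) (col-product x))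
                                      (ℤP.*-comm (ind (c (π x) (π e)) a) (ind (c (π (g ⁻¹)) (π x)) b))) ⟩
    sumFin n (λ x → F (π x))
      ≡⟨ sum-over-cosets F ⟩
    fibreSize (π e) * sumFin m F
      ≡⟨ cong (fibreSize (π e) *_) (proj₂ (closed b a) (π (g ⁻¹)) (π e)) ⟩
    fibreSize (π e) * sumFin r (λ k → proj₁ (closed b a) k * ind (c (π (g ⁻¹)) (π e)) k)
      ≡⟨ cong (λ t → fibreSize (π e) * sumFin r (λ k → proj₁ (closed b a) k * ind t k)) col-g ⟩
    fibreSize (π e) * sumFin r (λ k → proj₁ (closed b a) k * ind (col g) k) ∎
    where
    open ≡-Reasoning
    F : Fin m → ℤ
    F γ = adj c b (π (g ⁻¹)) γ * adj c a γ (π e)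
    col-g : c (π (g ⁻¹)) (π e) ≡ col g
    col-g = trans (c-col (g ⁻¹) e) (cong col (trans (identityˡ _) (⁻¹-involutive g)))
    col-product : ∀ x → col (x ⁻¹ ⁻¹ ∙ g) ≡ c (π (g ⁻¹)) (π x)
    col-product x = trans (cong (λ t → col (t ∙ g)) (⁻¹-involutive x))
                          (sym (trans (c-col (g ⁻¹) x) (cong (λ t → col (x ∙ t)) (⁻¹-involutive g))))

  x⁻¹g≡e⇔g≡x : ∀ x g → (x ⁻¹ ∙ g ≡ e) ⇔ (g ≡ x)
  x⁻¹g≡e⇔g≡x x g = mk⇔ (λ p → trans (inverseʳ-unique (x ⁻¹) g p) (⁻¹-involutive x))
                        (λ { refl → inverseˡ g })

  u-count-zeroˡ : ∀ j g → structureCount u zero j g ≡ ind (u g) j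
  u-count-zeroˡ j g = begin
    sumFin n (λ x → ind (u x) zero * ind (u (x ⁻¹ ∙ g)) j)
      ≡⟨ sumFin-cong n (λ x → cong (_* ind (u (x ⁻¹ ∙ g)) j) (ind-u-zero x)) ⟩
    sumFin n (λ x → ind x e * ind (u (x ⁻¹ ∙ g)) j)
      ≡⟨ sumFin-delta n e _ ⟩
    ind (u (e ⁻¹ ∙ g)) j
      ≡⟨ cong (λ t → ind (u t) j) (trans (cong (_∙ g) ε⁻¹≈ε) (identityˡ g)) ⟩
    ind (u g) j ∎
    where open ≡-Reasoning

  u-count-zeroʳ : ∀ i g → structureCount u i zero g ≡ ind (u g) i
  u-count-zeroʳ i g = begin
    sumFin n (λ x → ind (u x) i * ind (u (x ⁻¹ ∙ g)) zero)
      ≡⟨ sumFin-cong n (λ x → cong (ind (u x) i *_) (trans (ind-u-zero _) (ind-iff (x⁻¹g≡e⇔g≡x x g)))) ⟩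
    sumFin n (λ x → ind (u x) i * ind g x)
      ≡⟨ sumFin-delta′ n g (λ x → ind (u x) i) ⟩
    ind (u g) i ∎
    where open ≡-Reasoning

  -- the terms by which the structure counts of u and col differ; they
  -- depend only on u g
  correction : Fin r → Fin r → Fin (suc r) → ℤ
  correction a b t = ind d b * ind t (suc a) + (ind d a * ind t (suc b) + ind d a * ind d b * ind t zero)

  col-count-via-u : ∀ a b g →
    structureCount col a b g ≡ structureCount u (suc a) (suc b) g + correction a b (u g)
  col-count-via-u a b g = begin
    sumFin n (λ x → ind (col x) a * ind (col (x ⁻¹ ∙ g)) b)
      ≡⟨ sumFin-cong n (λ x → trans (sym (cong₂ _*_ (ind-u-suc x a) (ind-u-suc (x ⁻¹ ∙ g) b)))
                                      (expand (B₁ x) (E₁ x) (B₂ x) (E₂ x) δa δb)) ⟩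
    sumFin n (λ x → B₁ x * B₂ x + (δb * (B₁ x * E₂ x) + (δa * (E₁ x * B₂ x) + δa * δb * (E₁ x * E₂ x))))
      ≡⟨ trans (sumFin-+ n _ _) (cong (structureCount u (suc a) (suc b) g +_)
           (trans (sumFin-+ n _ _) (cong₂ _+_ (sumFin-*ˡ n δb _)
             (trans (sumFin-+ n _ _) (cong₂ _+_ (sumFin-*ˡ n δa _) (sumFin-*ˡ n (δa * δb) _)))))) ⟩
    structureCount u (suc a) (suc b) g
      + (δb * sumFin n (λ x → B₁ x * E₂ x) + (δa * sumFin n (λ x → E₁ x * B₂ x) + δa * δb * sumFin n (λ x → E₁ x * E₂ x)))
      ≡⟨ cong (structureCount u (suc a) (suc b) g +_)
           (cong₂ _+_ (cong (δb *_) at-g) (cong₂ _+_ (cong (δa *_) at-e) (cong (δa * δb *_) at-e-and-g))) ⟩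
    structureCount u (suc a) (suc b) g + correction a b (u g) ∎
    where
    open ≡-Reasoning
    δa δb : ℤ
    δa = ind d a
    δb = ind d b
    B₁ E₁ B₂ E₂ : Fin n → ℤ
    B₁ x = ind (u x) (suc a)
    E₁ x = ind x e
    B₂ x = ind (u (x ⁻¹ ∙ g)) (suc b)
    E₂ x = ind (x ⁻¹ ∙ g) e
    expand : ∀ (B₁ E₁ B₂ E₂ δa δb : ℤ) → (B₁ + E₁ * δa) * (B₂ + E₂ * δb)
      ≡ B₁ * B₂ + (δb * (B₁ * E₂) + (δa * (E₁ * B₂) + δa * δb * (E₁ * E₂)))
    expand = solve-∀
    e⁻¹g≡g : e ⁻¹ ∙ g ≡ g
    e⁻¹g≡g = trans (cong (_∙ g) ε⁻¹≈ε) (identityˡ g)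
    at-g : sumFin n (λ x → B₁ x * E₂ x) ≡ ind (u g) (suc a)
    at-g = trans (sumFin-cong n (λ x → cong (B₁ x *_) (ind-iff (x⁻¹g≡e⇔g≡x x g)))) (sumFin-delta′ n g B₁)
    at-e : sumFin n (λ x → E₁ x * B₂ x) ≡ ind (u g) (suc b)
    at-e = trans (sumFin-delta n e B₂) (cong (λ t → ind (u t) (suc b)) e⁻¹g≡g)
    at-e-and-g : sumFin n (λ x → E₁ x * E₂ x) ≡ ind (u g) zero
    at-e-and-g = trans (sumFin-delta n e E₂) (trans (cong (λ t → ind t e) e⁻¹g≡g) (sym (ind-u-zero g)))

  u-isSRingPartition : IsSRingPartition u
  u-isSRingPartition = record { unit = unit ; inverse = inverse ; closed = closed-u }
    where
    unit : ∀ x → u x ≡ u e → x ≡ e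
    unit x p = u-zero x (trans p (u-e refl))
    ≢e⇒⁻¹≢e : ∀ {x} → x ≢ e → x ⁻¹ ≢ e
    ≢e⇒⁻¹≢e {x} x≢e q = x≢e (trans (sym (⁻¹-involutive x)) (trans (cong _⁻¹ q) ε⁻¹≈ε))
    inverse : ∀ x y → u x ≡ u y → u (x ⁻¹) ≡ u (y ⁻¹)
    inverse x y p = by-cases (x ≟ e)
      where
      open ≡-Reasoning
      by-cases : Dec (x ≡ e) → u (x ⁻¹) ≡ u (y ⁻¹)
      by-cases (yes x≡e) = trans (u-e (⁻¹≡e x≡e)) (sym (u-e (⁻¹≡e (u-zero y (trans (sym p) (u-e x≡e))))))
        where
        ⁻¹≡e : ∀ {z} → z ≡ e → z ⁻¹ ≡ e
        ⁻¹≡e refl = ε⁻¹≈ε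
      by-cases (no x≢e) = begin
        u (x ⁻¹)          ≡⟨ u-ne (≢e⇒⁻¹≢e x≢e) ⟩
        suc (col (x ⁻¹))  ≡⟨ cong suc (col-inverse-determined x y (u-determines-col x y p)) ⟩
        suc (col (y ⁻¹))  ≡˘⟨ u-ne (≢e⇒⁻¹≢e y≢e) ⟩
        u (y ⁻¹)          ∎
        where
        y≢e : y ≢ e
        y≢e y≡e = x≢e (u-zero x (trans p (u-e y≡e)))
    closed-u : ∀ i j g g′ → u g ≡ u g′ → structureCount u i j g ≡ structureCount u i j g′
    closed-u zero j g g′ p =
      trans (u-count-zeroˡ j g) (trans (cong (λ t → ind t j) p) (sym (u-count-zeroˡ j g′)))
    closed-u (suc a) zero g g′ p =
      trans (u-count-zeroʳ (suc a) g) (trans (cong (λ t → ind t (suc a)) p) (sym (u-count-zeroʳ (suc a) g′)))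
    closed-u (suc a) (suc b) g g′ p = +-cancelʳ (correction a b (u g)) _ _ (begin
      structureCount u (suc a) (suc b) g + correction a b (u g)   ≡˘⟨ col-count-via-u a b g ⟩
      structureCount col a b g                                   ≡⟨ col-count a b g ⟩
      fibreSize (π e) * sumFin r (λ k → proj₁ (closed b a) k * ind (col g) k)
        ≡⟨ cong (λ t → fibreSize (π e) * sumFin r (λ k → proj₁ (closed b a) k * ind t k)) (u-determines-col g g′ p) ⟩
      fibreSize (π e) * sumFin r (λ k → proj₁ (closed b a) k * ind (col g′) k)  ≡˘⟨ col-count a b g′ ⟩
      structureCount col a b g′                                  ≡⟨ col-count-via-u a b g′ ⟩
      structureCount u (suc a) (suc b) g′ + correction a b (u g′) ≡˘⟨ cong (λ t → structureCount u (suc a) (suc b) g′ + correction a b t) p ⟩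
      structureCount u (suc a) (suc b) g′ + correction a b (u g) ∎)
      where open ≡-Reasoning

  col-surjective : Surjective col
  col-surjective a with surj a
  ... | α , β , cαβ≡a = rep β ∙ rep α ⁻¹ ,
        trans (sym (c-col (rep α) (rep β))) (trans (cong₂ c (rep-spec α) (rep-spec β)) cαβ≡a)

  -- u uses every colour, except suc d when H is trivial
  u-hits : ∀ j → j ≢ suc d → ∃[ x ] u x ≡ j
  u-hits zero    _  = e , u-e refl
  u-hits (suc a) j≢ with col-surjective a
  ... | x , col-x = x , trans (u-ne x≢e) (cong suc col-x)
    where
    x≢e : x ≢ e
    x≢e x≡e = j≢ (cong suc (trans (sym col-x) (trans (cong col x≡e) col-e)))

  u-hits-nontrivial : ∀ h → π h ≡ π e → h ≢ e → u h ≡ suc d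
  u-hits-nontrivial h πh≡πe h≢e = trans (u-ne h≢e) (cong suc (Equivalence.from (col-d h) (sym πh≡πe)))

  u-misses-trivial : (∀ x → π x ≡ π e → x ≡ e) → ∀ x → u x ≢ suc d
  u-misses-trivial trivial x ux≡ = x≢e (trivial x (sym (Equivalence.to (col-d x) col-x≡d)))
    where
    x≢e : x ≢ e
    x≢e x≡e with trans (sym (u-e x≡e)) ux≡
    ... | ()
    col-x≡d : col x ≡ d
    col-x≡d = trans (sym (forget-u x)) (cong forget ux≡)

  u-compression : Compression u
  u-compression with FinP.any? (λ h → (π h ≟ π e) ×-dec ¬? (h ≟ e))
  ... | yes (h , πh≡πe , h≢e) = identityCompression u-surjective
    where
    u-surjective : Surjective u
    u-surjective j with j ≟ suc d
    ... | yes refl = h , u-hits-nontrivial h πh≡πe h≢e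
    ... | no j≢    = u-hits j j≢
  ... | no no-h = punchOutCompression (suc d) (u-misses-trivial trivial) u-hits
    where
    trivial : ∀ x → π x ≡ π e → x ≡ e
    trivial x πx≡πe with x ≟ e
    ... | yes x≡e = x≡e
    ... | no x≢e  = ⊥-elim (no-h (x , πx≡πe , x≢e))

  module Descent (schur : IsSchurGroup G) where
    open SchurianPartition (schurian-partition u-isSRingPartition u-compression schur)
    open IsPermGroup isPermGroup

    rightMult∈Γ′ : ∀ g → Γ′ (rightMult g)
    rightMult∈Γ′ g = has-rightMult g (rightMult g) (λ _ → refl)

    -- conjugating τ ∈ Γ′ by right translations gives an element of the
    -- stabiliser of e, so τ preserves the u-class of the quotient y x⁻¹
    quotient-class-invariant : ∀ τ → Γ′ τ → ∀ x y → u ((τ ⟨$⟩ʳ y) ∙ (τ ⟨$⟩ʳ x) ⁻¹) ≡ u (y ∙ x ⁻¹)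
    quotient-class-invariant τ τ∈Γ′ x y = sym (Equivalence.from (orbits _ _) (κ , κ∈Γ′ , κ-fixes-e , κ-maps))
      where
      κ : Permutation′ n
      κ = rightMult x ∘ₚ τ ∘ₚ rightMult ((τ ⟨$⟩ʳ x) ⁻¹)
      κ∈Γ′ : Γ′ κ
      κ∈Γ′ = ∘-closed (rightMult∈Γ′ x) (∘-closed τ∈Γ′ (rightMult∈Γ′ _))
      κ-fixes-e : κ ⟨$⟩ʳ e ≡ e
      κ-fixes-e = trans (cong (λ t → (τ ⟨$⟩ʳ t) ∙ (τ ⟨$⟩ʳ x) ⁻¹) (identityˡ x)) (inverseʳ _)
      κ-maps : κ ⟨$⟩ʳ (y ∙ x ⁻¹) ≡ (τ ⟨$⟩ʳ y) ∙ (τ ⟨$⟩ʳ x) ⁻¹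
      κ-maps = cong (λ t → (τ ⟨$⟩ʳ t) ∙ (τ ⟨$⟩ʳ x) ⁻¹) (//-rightDividesˡ x y)

    Γ′-compatible : ∀ τ → Γ′ τ → Compatible (τ ⟨$⟩ʳ_)
    Γ′-compatible τ τ∈Γ′ x y πx≡πy = Equivalence.from (same-coset _ _)
      (trans (u-determines-col _ _ (quotient-class-invariant τ τ∈Γ′ x y))
             (Equivalence.to (same-coset x y) πx≡πy))

    lift : ∀ τ → Γ′ τ → Σ (Permutation′ m) (Induces τ)
    lift τ τ∈Γ′ = induce τ (Γ′-compatible τ τ∈Γ′) (Γ′-compatible (flip τ) (inv-closed τ∈Γ′))

    Δ : Permutation′ m → Set
    Δ = Induced Γ′

    Δ-preserves-c : ∀ α β α′ β′ → SameOrbit₂ Δ α β α′ β′ → c α β ≡ c α′ β′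
    Δ-preserves-c α β α′ β′ (σ , (τ , τ∈Γ′ , σ-τ) , σα , σβ) = begin
      c α β                                     ≡˘⟨ cong₂ c (rep-spec α) (rep-spec β) ⟩
      c (π x) (π y)                             ≡⟨ c-col x y ⟩
      col (y ∙ x ⁻¹)                            ≡˘⟨ u-determines-col _ _ (quotient-class-invariant τ τ∈Γ′ x y) ⟩
      col ((τ ⟨$⟩ʳ y) ∙ (τ ⟨$⟩ʳ x) ⁻¹)          ≡˘⟨ c-col _ _ ⟩
      c (π (τ ⟨$⟩ʳ x)) (π (τ ⟨$⟩ʳ y))           ≡˘⟨ cong₂ c (σ-τ x) (σ-τ y) ⟩
      c (σ ⟨$⟩ʳ π x) (σ ⟨$⟩ʳ π y)               ≡⟨ cong₂ (λ s t → c (σ ⟨$⟩ʳ s) (σ ⟨$⟩ʳ t)) (rep-spec α) (rep-spec β) ⟩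
      c (σ ⟨$⟩ʳ α) (σ ⟨$⟩ʳ β)                   ≡⟨ cong₂ c σα σβ ⟩
      c α′ β′                                   ∎
      where
      open ≡-Reasoning
      x y : Fin n
      x = rep α
      y = rep β

    orbit-from-Γ′ : ∀ {β β′} x x′ y τ → Γ′ τ → τ ⟨$⟩ʳ x ≡ x′ → π (τ ⟨$⟩ʳ y) ≡ β′ → π y ≡ β →
      SameOrbit₂ Δ (π x) β (π x′) β′
    orbit-from-Γ′ x x′ y τ τ∈Γ′ τx τy refl with lift τ τ∈Γ′
    ... | σ , σ-τ = σ , (τ , τ∈Γ′ , σ-τ) , trans (σ-τ x) (cong π τx) , trans (σ-τ y) τy

    -- if yx⁻¹ and y′x′⁻¹ have the same u-colour, some τ ∈ Γ′ maps (x, y)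
    -- to (x′, y′): conjugate a stabiliser element carrying yx⁻¹ to y′x′⁻¹
    Γ′-transports : ∀ x y x′ y′ → u (y ∙ x ⁻¹) ≡ u (y′ ∙ x′ ⁻¹) →
      Σ (Permutation′ n) λ τ → Γ′ τ × (τ ⟨$⟩ʳ x ≡ x′) × (τ ⟨$⟩ʳ y ≡ y′)
    Γ′-transports x y x′ y′ same with Equivalence.to (orbits _ _) same
    ... | κ , κ∈Γ′ , κe≡e , κz≡z′ = τ , τ∈Γ′ , τx≡x′ , τy≡y′
      where
      τ : Permutation′ n
      τ = rightMult (x ⁻¹) ∘ₚ κ ∘ₚ rightMult x′
      τ∈Γ′ : Γ′ τ
      τ∈Γ′ = ∘-closed (rightMult∈Γ′ _) (∘-closed κ∈Γ′ (rightMult∈Γ′ _))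
      τx≡x′ : τ ⟨$⟩ʳ x ≡ x′
      τx≡x′ = trans (cong (λ t → (κ ⟨$⟩ʳ t) ∙ x′) (inverseʳ x)) (trans (cong (_∙ x′) κe≡e) (identityˡ x′))
      τy≡y′ : τ ⟨$⟩ʳ y ≡ y′
      τy≡y′ = trans (cong (_∙ x′) κz≡z′) (//-rightDividesˡ x′ y′)

    c-classes-are-Δ-orbits : ∀ α β α′ β′ → c α β ≡ c α′ β′ → SameOrbit₂ Δ α β α′ β′
    c-classes-are-Δ-orbits α β α′ β′ p =
      subst₂ (λ s t → SameOrbit₂ Δ s β t β′) (rep-spec α) (rep-spec α′) (by-cases (col z ≟ d))
      where
      x y x′ y′ z z′ : Fin n
      x = rep α
      y = rep β
      x′ = rep α′
      y′ = rep β′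
      z = y ∙ x ⁻¹
      z′ = y′ ∙ x′ ⁻¹
      col-z : col z ≡ col z′
      col-z = trans (sym (c-col x y)) (trans (cong₂ c (rep-spec α) (rep-spec β))
                (trans p (trans (sym (cong₂ c (rep-spec α′) (rep-spec β′))) (c-col x′ y′))))
      -- off the diagonal colour z, z′ ≠ e, so u z = u z′
      u-z : col z ≢ d → u z ≡ u z′
      u-z z-not-in-H = trans (u-ne (λ z≡e → z-not-in-H (trans (cong col z≡e) col-e)))
        (trans (cong suc col-z) (sym (u-ne (λ z′≡e → z-not-in-H (trans col-z (trans (cong col z′≡e) col-e))))))
      by-cases : Dec (col z ≡ d) → SameOrbit₂ Δ (π x) β (π x′) β′
      -- both pairs lie in a coset: a right translation carries one to the other
      by-cases (yes z-in-H) = orbit-from-Γ′ x x′ y (rightMult g) (rightMult∈Γ′ g) xg≡x′ πyg (rep-spec β)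
        where
        g : Fin n
        g = x ⁻¹ ∙ x′
        xg≡x′ : x ∙ g ≡ x′
        xg≡x′ = trans (sym (assoc _ _ _)) (trans (cong (_∙ x′) (inverseʳ x)) (identityˡ x′))
        πyg : π (y ∙ g) ≡ β′
        πyg = trans (sym (rightMult-compatible g x y (Equivalence.from (same-coset x y) z-in-H)))
                (trans (cong π xg≡x′) (trans (Equivalence.from (same-coset x′ y′) (trans (sym col-z) z-in-H))
                  (rep-spec β′)))
      by-cases (no z-not-in-H) with Γ′-transports x y x′ y′ (u-z z-not-in-H)
      ... | τ , τ∈Γ′ , τx≡x′ , τy≡y′ =
        orbit-from-Γ′ x x′ y τ τ∈Γ′ τx≡x′ (trans (cong π τy≡y′) (rep-spec β′)) (rep-spec β)

    c-is-inv-Δ : IsInvOf c Δ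
    c-is-inv-Δ α β α′ β′ = mk⇔ (c-classes-are-Δ-orbits α β α′ β′) (Δ-preserves-c α β α′ β′)

    Δ-isPermGroup : IsPermGroup Δ
    Δ-isPermGroup = induced-isPermGroup isPermGroup

lemma2p3 : ∀ {n} (G : FinGroup n) → IsSchurGroup G →
    (H : Fin n → Set) → IsSubgroup G H →
    (m : ℕ) (π : Fin n → Fin m) → IsRightCosetSpace G H m π →
    ∀ (r : ℕ) (c : Fin m → Fin m → Fin r) →
    IsFusionOfInv (InducedGroup G π) c → IsSchurianScheme c
lemma2p3 G schur H _ m π coset-space r c fusion = Δ , Δ-isPermGroup , c-is-inv-Δ
  where open Fusion.Descent G H m π coset-space r c fusion schur
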